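{- Let $G$ be a graph in which $u_1,\dots,u_k$ ($k\ge1$) are pairwise false twins, and let $d=d_G(u_1)$. Then $\mathbb{E}\rho(G-u_1)\ge\mathbb{E}\rho(G)-\frac{2^d-1}{2^{k+d-1}}$. In particular, if $d_G(u_1)=1$ then $\mathbb{E}\rho(G-u_1)\ge\mathbb{E}\rho(G)-2^{ -k}$.
   Context: Graphs are finite and simple. $\rho_G(X)$ is the binary rank of the $X\times(V(G)\setminus X)$ adjacency submatrix; $\mathbb{E}\rho(G)=2^{ -|V(G)|}\sum_{S\subseteq V(G)}\rho_G(S)$. Distinct vertices $x,y$ are false twins if they are nonadjacent and $N(x)=N(y)$. $d_G(v)$ is the degree of $v$. -}

module Defs where

open import Data.Bool using (Bool; true; false; _∧_; _∨_; not; _xor_; if_then_else_)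
open import Data.Nat using (ℕ; zero; suc; _⊔_; _^_)
open import Data.Nat.Properties using (m^n≢0)
open import Data.Integer using (ℤ; +_)
open import Data.Rational using (ℚ; _/_)
open import Data.Fin using (Fin; zero; suc; punchIn)
open import Data.Fin.Subset using (Subset; ∣_∣)
open import Data.Vec using (Vec; []; _∷_; lookup; tabulate; replicate; zipWith)
open import Data.List as List using (List)
import Data.Bool.ListAction as BL
import Data.Nat.ListAction as NL
open import Data.Product using (_×_)
open import Relation.Binary.PropositionalEquality using (_≡_; _≢_)

record Graph (n : ℕ) : Set where
  field
    adj    : Fin n → Fin n → Bool
    sym    : ∀ i j → adj i j ≡ adj j i
    irrefl : ∀ i → adj i i ≡ false
open Graph public

deleteVertex : ∀ {n} → Graph (suc n) → Fin (suc n) → Graph n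
deleteVertex G v = record
  { adj    = λ i j → adj G (punchIn v i) (punchIn v j)
  ; sym    = λ i j → sym G (punchIn v i) (punchIn v j)
  ; irrefl = λ i → irrefl G (punchIn v i)
  }

degree : ∀ {n} → Graph n → Fin n → ℕ
degree G v = ∣ tabulate (adj G v) ∣

FalseTwins : ∀ {n} → Graph n → Fin n → Fin n → Set
FalseTwins G x y = (x ≢ y) × (adj G x y ≡ false) × (∀ z → adj G x z ≡ adj G y z)

zeroV : ∀ {c} → Vec Bool c
zeroV = replicate _ false

_⊕_ : ∀ {c} → Vec Bool c → Vec Bool c → Vec Bool c
_⊕_ = zipWith _xor_

isZero : ∀ {c} → Vec Bool c → Bool
isZero []       = true
isZero (b ∷ v)  = not b ∧ isZero v

nonEmpty : ∀ {m} → Subset m → Bool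
nonEmpty []      = false
nonEmpty (b ∷ U) = b ∨ nonEmpty U

_⊆ᵇ_ : ∀ {m} → Subset m → Subset m → Bool
[]      ⊆ᵇ []      = true
(a ∷ U) ⊆ᵇ (b ∷ T) = (not a ∨ b) ∧ (U ⊆ᵇ T)

allSubsets : (m : ℕ) → List (Subset m)
allSubsets zero    = List.[ [] ]
allSubsets (suc m) = List.map (false ∷_) (allSubsets m) List.++ List.map (true ∷_) (allSubsets m)

sumRows : ∀ {m c} → (Fin m → Vec Bool c) → Subset m → Vec Bool c
sumRows {zero}  r []      = zeroV
sumRows {suc m} r (b ∷ U) = (if b then r zero else zeroV) ⊕ sumRows (λ i → r (suc i)) U

independent : ∀ {m c} → (Fin m → Vec Bool c) → Subset m → Bool
independent {m} r T =
  BL.all (λ U → not ((U ⊆ᵇ T) ∧ nonEmpty U) ∨ not (isZero (sumRows r U))) (allSubsets m)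

rankGF2 : ∀ {m c} → (Fin m → Vec Bool c) → Subset m → ℕ
rankGF2 {m} r S =
  List.foldr _⊔_ 0
    (List.map ∣_∣ (List.filterᵇ (λ T → (T ⊆ᵇ S) ∧ independent r T) (allSubsets m)))

-- cut-rank ρ_G(X): GF(2)-rank of the X × (V∖X) adjacency submatrix.
-- (Row x ∈ X is stored as a length-n vector whose entries at columns in X are
--  zero; zero columns do not affect the rank.)
cutRank : ∀ {n} → Graph n → Subset n → ℕ
cutRank {n} G X = rankGF2 (λ x → tabulate (λ y → adj G x y ∧ not (lookup X y))) X

_/2^_ : ℤ → ℕ → ℚ
z /2^ e = _/_ z (2 ^ e) {{m^n≢0 2 e}}

Eρ : ∀ {n} → Graph n → ℚ
Eρ {n} G = (+ NL.sum (List.map (cutRank G) (allSubsets n))) /2^ n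

module Submission where

-- Write u for u₁ and G′ for G - u. Each X ⊆ V(G) is S or S ∪ {u} with S ⊆ V(G′), and the cut-rank
-- matrix of X is that of S with one extra row (u ∈ X) or one extra column (u ∉ X), so
-- ρ_G(X) ≤ ρ_G′(S) + 1. The extra row or column adds nothing to the GF(2)-rank when another
-- twin u_i lies on the same side as u (it duplicates the row or column of u_i) or when every
-- neighbour of u does (it vanishes on the relevant part of the matrix). The remaining sets S put
-- all k - 1 other twins on the opposite side and not all d neighbours on the side of u, and for
-- either side there are exactly 2^(|V(G′)| - k + 1 - d) (2^d - 1) of them. Averaging over X gives
-- 𝔼ρ(G) ≤ 𝔼ρ(G′) + (2^d - 1) / 2^(k + d - 1).

open import Defs renaming (sym to adj-sym)
open import Algebra.Bundles using (CommutativeSemigroup)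
import Algebra.Properties.CommutativeSemigroup as CommutativeSemigroupProperties
import Data.Bool.ListAction as BoolList
open import Data.Bool using (Bool; true; false; _∧_; _∨_; not; _xor_; if_then_else_)
open import Data.Bool.Properties
  using (∧-zeroʳ; ∧-identityʳ; xor-assoc; xor-comm; xor-identityˡ; xor-identityʳ; xor-same; T-≡)
open import Data.Empty using (⊥-elim)
open import Data.Fin using (Fin; zero; suc; punchIn; punchOut; _≟_)
open import Data.Fin.Properties using (punchIn-punchOut; suc-injective)
open import Data.Fin.Subset using (Subset; ∣_∣; _∈_; _∉_; _⊆_; Nonempty; ⁅_⁆; _∪_) renaming (⊥ to ∅; _-_ to _∖_)
open import Data.Fin.Subset.Properties
  using (∉⊥; ∣⊥∣≡0; ∣⁅x⁆∣≡1; x∈p∪q⁻; x∈p∪q⁺; drop-∷-⊆; x∈⁅y⁆⇒x≡y; p─⊥≡p; p─q⊆p)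
open import Data.Integer using (+_)
open import Data.List as List using (List)
open import Data.List.Membership.Propositional using () renaming (_∈_ to _∈ₗ_)
open import Data.List.Membership.Propositional.Properties
  using (∈-map⁺; ∈-map⁻; ∈-++⁺ˡ; ∈-++⁺ʳ; ∈-filter⁺; ∈-filter⁻; foldr-selective)
open import Data.List.Properties using (foldr-preservesᵒ; map-++; map-∘; map-cong)
import Data.List.Relation.Unary.Any as Any
open import Data.Nat using (ℕ; zero; suc; pred; _+_; _*_; _^_; _∸_; z≤n; s≤s)
open import Data.Nat.ListAction using (sum)
open import Data.Nat.ListAction.Properties using (sum-++)
open import Data.Nat.Properties
  using (module ≤-Reasoning; ≤-trans; ≤-reflexive; m≤m⊔n; m≤n⊔m; ⊔-sel; m≤n⇒m≤1+n; m≤m+n; +-mono-≤;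
         *-monoˡ-≤; +-comm; +-suc; +-identityʳ; *-identityʳ; *-assoc; *-distribʳ-+; *-distribˡ-∸;
         m+n∸n≡m; ^-distribˡ-+-*; m^n≢0; suc-pred)
open import Data.Nat.Tactic.RingSolver using (solve-∀)
open import Data.Product using (_×_; _,_; ∃; ∃₂; proj₁; proj₂)
open import Data.Sum using (_⊎_; inj₁; inj₂; [_,_])
open import Data.Vec using (Vec; []; _∷_; here; there; map; lookup; tabulate; insertAt; removeAt)
open import Data.Vec.Properties
  using (zipWith-identityˡ; zipWith-identityʳ; zipWith-assoc; zipWith-comm; lookup-zipWith; lookup-replicate;
         lookup-map; lookup∘tabulate; tabulate∘lookup; tabulate-cong; insertAt-lookup; insertAt-punchIn;
         insertAt-removeAt; []=⇒lookup; lookup⇒[]=)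
open import Function using (_∘_; Equivalence; Injective)
open import Relation.Binary.PropositionalEquality
  using (_≡_; _≢_; refl; sym; trans; cong; cong₂; subst; subst₂; isEquivalence; module ≡-Reasoning)
open import Relation.Nullary using (¬_; yes; no; contradiction)
open import Relation.Nullary.Decidable using (T?)

private
  variable
    c m : ℕ

∧-true⁻ : ∀ {x y} → x ∧ y ≡ true → x ≡ true × y ≡ true
∧-true⁻ {true} {true} _ = refl , refl

module Subsets where

  lookup-ext : ∀ {A : Set} {v w : Vec A c} → (∀ t → lookup v t ≡ lookup w t) → v ≡ w
  lookup-ext {v = v} {w} h = trans (sym (tabulate∘lookup v)) (trans (tabulate-cong h) (tabulate∘lookup w))

  punchIn-view : ∀ (u y : Fin (suc m)) → y ≡ u ⊎ ∃ λ j → punchIn u j ≡ y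
  punchIn-view u y with y ≟ u
  ... | yes y≡u = inj₁ y≡u
  ... | no  y≢u = inj₂ (punchOut (y≢u ∘ sym) , punchIn-punchOut (y≢u ∘ sym))

  tabulate-insertAt : ∀ {A : Set} (f : Fin (suc m) → A) u → tabulate f ≡ insertAt (tabulate (f ∘ punchIn u)) u (f u)
  tabulate-insertAt f u = lookup-ext λ y → entry y (punchIn-view u y)
    where
    entry : ∀ y → y ≡ u ⊎ ∃ (λ j → punchIn u j ≡ y) →
            lookup (tabulate f) y ≡ lookup (insertAt (tabulate (f ∘ punchIn u)) u (f u)) y
    entry .u (inj₁ refl) = trans (lookup∘tabulate f u) (sym (insertAt-lookup _ u (f u)))
    entry .(punchIn u j) (inj₂ (j , refl)) =
      trans (lookup∘tabulate f (punchIn u j)) (sym (trans (insertAt-punchIn _ u (f u) j) (lookup∘tabulate (f ∘ punchIn u) j)))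

  ∈⇒lookup : ∀ {x} {U : Subset m} → x ∈ U → lookup U x ≡ true
  ∈⇒lookup = []=⇒lookup

  lookup⇒∈ : ∀ {x} {U : Subset m} → lookup U x ≡ true → x ∈ U
  lookup⇒∈ = lookup⇒[]= _ _

  ∉⇒lookup : ∀ {x} {U : Subset m} → x ∉ U → lookup U x ≡ false
  ∉⇒lookup {x = x} {U} x∉U with lookup U x in eq
  ... | true  = contradiction (lookup⇒∈ eq) x∉U
  ... | false = refl

  insertAt-view : ∀ (T : Subset (suc m)) u → ∃₂ λ T′ a → T ≡ insertAt T′ u a
  insertAt-view T u = removeAt T u , lookup T u , sym (insertAt-removeAt T u)

  ∈-insertAt⁺ : ∀ {U : Subset m} {x} u b → x ∈ U → punchIn u x ∈ insertAt U u b
  ∈-insertAt⁺ {U = U} {x} u b x∈U = lookup⇒∈ (trans (insertAt-punchIn U u b x) (∈⇒lookup x∈U))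

  ∈-insertAt⁻ : ∀ {U : Subset m} {x} u b → punchIn u x ∈ insertAt U u b → x ∈ U
  ∈-insertAt⁻ {U = U} {x} u b x∈ = lookup⇒∈ (trans (sym (insertAt-punchIn U u b x)) (∈⇒lookup x∈))

  ∈-insertAt-self : ∀ (U : Subset m) u → u ∈ insertAt U u true
  ∈-insertAt-self U u = lookup⇒∈ (insertAt-lookup U u true)

  ∈-insertAt-self⁻ : ∀ {U : Subset m} {u b} → u ∈ insertAt U u b → b ≡ true
  ∈-insertAt-self⁻ {U = U} {u} {b} u∈ = trans (sym (insertAt-lookup U u b)) (∈⇒lookup u∈)

  insertAt-mono : ∀ {U T : Subset m} {b c} u → U ⊆ T → (b ≡ true → c ≡ true) → insertAt U u b ⊆ insertAt T u c
  insertAt-mono {T = T} zero U⊆T b⇒c here       = subst (λ c → zero ∈ insertAt T zero c) (sym (b⇒c refl)) here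
  insertAt-mono         zero U⊆T b⇒c (there x∈) = there (U⊆T x∈)
  insertAt-mono {U = true ∷ U} {_ ∷ T} (suc u) U⊆T b⇒c here with U⊆T here
  ... | here = here
  insertAt-mono {U = _ ∷ U} {_ ∷ T} (suc u) U⊆T b⇒c (there x∈) = there (insertAt-mono u (drop-∷-⊆ U⊆T) b⇒c x∈)

  insertAt-⊆⁻ : ∀ {U T : Subset m} {b c} u → insertAt U u b ⊆ insertAt T u c → U ⊆ T × (b ≡ true → c ≡ true)
  insertAt-⊆⁻ {U = U} u sub =
    (λ x∈U → ∈-insertAt⁻ u _ (sub (∈-insertAt⁺ u _ x∈U))) ,
    (λ { refl → ∈-insertAt-self⁻ (sub (∈-insertAt-self U u)) })

  ⊆-insertAt-view : ∀ {U : Subset (suc m)} {T b} u → U ⊆ insertAt T u b →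
                    ∃₂ λ U′ a → U ≡ insertAt U′ u a × U′ ⊆ T × (a ≡ true → b ≡ true)
  ⊆-insertAt-view {U = U} u U⊆ with insertAt-view U u
  ... | U′ , a , refl = U′ , a , refl , insertAt-⊆⁻ u U⊆

  Nonempty-insertAt : ∀ {U : Subset m} u b → Nonempty U → Nonempty (insertAt U u b)
  Nonempty-insertAt u b (x , x∈U) = punchIn u x , ∈-insertAt⁺ u b x∈U

  ∣insertAt-true∣ : ∀ (U : Subset m) u → ∣ insertAt U u true ∣ ≡ suc ∣ U ∣
  ∣insertAt-true∣ U           zero    = refl
  ∣insertAt-true∣ (true ∷ U)  (suc u) = cong suc (∣insertAt-true∣ U u)
  ∣insertAt-true∣ (false ∷ U) (suc u) = ∣insertAt-true∣ U u

  ∣insertAt-false∣ : ∀ (U : Subset m) u → ∣ insertAt U u false ∣ ≡ ∣ U ∣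
  ∣insertAt-false∣ U           zero    = refl
  ∣insertAt-false∣ (true ∷ U)  (suc u) = cong suc (∣insertAt-false∣ U u)
  ∣insertAt-false∣ (false ∷ U) (suc u) = ∣insertAt-false∣ U u

  x∉p∖x : ∀ (p : Subset m) x → x ∉ p ∖ x
  x∉p∖x (_ ∷ p) zero    ()
  x∉p∖x (_ ∷ p) (suc x) (there x∈) = x∉p∖x p x x∈

  suc∣p∖x∣ : ∀ (p : Subset m) {x} → x ∈ p → suc ∣ p ∖ x ∣ ≡ ∣ p ∣
  suc∣p∖x∣ (true  ∷ p) {zero}  here       = cong (suc ∘ ∣_∣) (p─⊥≡p p)
  suc∣p∖x∣ (true  ∷ p) {suc x} (there x∈) = cong suc (suc∣p∖x∣ p x∈)
  suc∣p∖x∣ (false ∷ p) {suc x} (there x∈) = suc∣p∖x∣ p x∈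

  ∈-⊕⁻ : ∀ {U W : Subset m} {x} → x ∈ U ⊕ W → x ∈ U ⊎ x ∈ W
  ∈-⊕⁻ {U = U} {W} {x} x∈ with lookup U x in x∈?U
  ... | true  = inj₁ (lookup⇒∈ x∈?U)
  ... | false = inj₂ (lookup⇒∈ (begin
    lookup W x                  ≡⟨ cong (_xor lookup W x) x∈?U ⟨
    lookup U x xor lookup W x   ≡⟨ lookup-zipWith _xor_ x U W ⟨
    lookup (U ⊕ W) x            ≡⟨ ∈⇒lookup x∈ ⟩
    true                        ∎))
    where open ≡-Reasoning

  ∈-⊕⁺ : ∀ {U W : Subset m} {x} → x ∈ U → x ∉ W → x ∈ U ⊕ W
  ∈-⊕⁺ {U = U} {W} {x} x∈U x∉W =
    lookup⇒∈ (trans (lookup-zipWith _xor_ x U W) (cong₂ _xor_ (∈⇒lookup x∈U) (∉⇒lookup x∉W)))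

  ∣∪∣-disjoint : ∀ (M N : Subset m) → (∀ {i} → i ∈ M → i ∉ N) → ∣ M ∪ N ∣ ≡ ∣ M ∣ + ∣ N ∣
  ∣∪∣-disjoint []      []      _        = refl
  ∣∪∣-disjoint (_ ∷ M) (_ ∷ N) disjoint with ∣∪∣-disjoint M N (λ i∈M i∈N → disjoint (there i∈M) (there i∈N))
  ∣∪∣-disjoint (true  ∷ M) (true  ∷ N) disjoint | _  = contradiction here (disjoint here)
  ∣∪∣-disjoint (true  ∷ M) (false ∷ N) disjoint | ih = cong suc ih
  ∣∪∣-disjoint (false ∷ M) (true  ∷ N) disjoint | ih = trans (cong suc ih) (sym (+-suc ∣ M ∣ ∣ N ∣))
  ∣∪∣-disjoint (false ∷ M) (false ∷ N) disjoint | ih = ih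

  image : ∀ {k} → (Fin k → Fin m) → Subset m
  image {k = zero}  p = ∅
  image {k = suc k} p = ⁅ p zero ⁆ ∪ image (p ∘ suc)

  ∈-image⁻ : ∀ {k} (p : Fin k → Fin m) {x} → x ∈ image p → ∃ λ i → p i ≡ x
  ∈-image⁻ {k = zero}  p x∈ = contradiction x∈ ∉⊥
  ∈-image⁻ {k = suc k} p x∈ with x∈p∪q⁻ ⁅ p zero ⁆ (image (p ∘ suc)) x∈
  ... | inj₁ x∈⁅p0⁆ = zero , sym (x∈⁅y⁆⇒x≡y (p zero) x∈⁅p0⁆)
  ... | inj₂ x∈rest with ∈-image⁻ (p ∘ suc) x∈rest
  ...   | i , pi≡x = suc i , pi≡x

  ∣image∣ : ∀ {k} (p : Fin k → Fin m) → Injective _≡_ _≡_ p → ∣ image p ∣ ≡ k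
  ∣image∣ {m} {zero}  p injective = ∣⊥∣≡0 m
  ∣image∣ {m} {suc k} p injective = begin
    ∣ ⁅ p zero ⁆ ∪ image (p ∘ suc) ∣
      ≡⟨ ∣∪∣-disjoint ⁅ p zero ⁆ (image (p ∘ suc)) disjoint ⟩
    ∣ ⁅ p zero ⁆ ∣ + ∣ image (p ∘ suc) ∣
      ≡⟨ cong₂ _+_ (∣⁅x⁆∣≡1 (p zero)) (∣image∣ (p ∘ suc) (suc-injective ∘ injective)) ⟩
    suc k ∎
    where
    open ≡-Reasoning
    disjoint : ∀ {x} → x ∈ ⁅ p zero ⁆ → x ∉ image (p ∘ suc)
    disjoint x∈⁅p0⁆ x∈rest with ∈-image⁻ (p ∘ suc) x∈rest
    ... | i , pi≡x = contradiction (injective (trans pi≡x (x∈⁅y⁆⇒x≡y (p zero) x∈⁅p0⁆))) λ ()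

module Rank where

  open import Data.Nat using (_≤_)
  open Subsets

  _•_ : Bool → Vec Bool c → Vec Bool c
  b • v = if b then v else zeroV

  infixr 30 _•_

  ⊕-identityˡ : (v : Vec Bool c) → zeroV ⊕ v ≡ v
  ⊕-identityˡ = zipWith-identityˡ xor-identityˡ

  ⊕-identityʳ : (v : Vec Bool c) → v ⊕ zeroV ≡ v
  ⊕-identityʳ = zipWith-identityʳ xor-identityʳ

  ⊕-self : (v : Vec Bool c) → v ⊕ v ≡ zeroV
  ⊕-self []          = refl
  ⊕-self (true ∷ v)  = cong (false ∷_) (⊕-self v)
  ⊕-self (false ∷ v) = cong (false ∷_) (⊕-self v)

  ⊕-commutativeSemigroup : ℕ → CommutativeSemigroup _ _
  ⊕-commutativeSemigroup c = record
    { Carrier = Vec Bool c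
    ; _≈_ = _≡_
    ; _∙_ = _⊕_
    ; isCommutativeSemigroup = record
      { isSemigroup = record
        { isMagma = record { isEquivalence = isEquivalence ; ∙-cong = cong₂ _⊕_ }
        ; assoc = zipWith-assoc xor-assoc }
      ; comm = zipWith-comm xor-comm }
    }

  module _ {c : ℕ} where
    open CommutativeSemigroupProperties (⊕-commutativeSemigroup c) public
      using () renaming (interchange to ⊕-interchange; x∙yz≈y∙xz to ⊕-leftSwap)

  •-distrib-xor : ∀ a b (v : Vec Bool c) → (a xor b) • v ≡ a • v ⊕ b • v
  •-distrib-xor true  true  v = sym (⊕-self v)
  •-distrib-xor true  false v = sym (⊕-identityʳ v)
  •-distrib-xor false b     v = sym (⊕-identityˡ (b • v))

  lookup-zeroV : (t : Fin c) → lookup zeroV t ≡ false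
  lookup-zeroV t = lookup-replicate t false

  isZero-sound : (v : Vec Bool c) → isZero v ≡ true → v ≡ zeroV
  isZero-sound []          _ = refl
  isZero-sound (false ∷ v) h = cong (false ∷_) (isZero-sound v h)

  isZero-zeroV : isZero (zeroV {c}) ≡ true
  isZero-zeroV {zero}  = refl
  isZero-zeroV {suc c} = isZero-zeroV {c}

  sumRows-cong : ∀ {r s : Fin m → Vec Bool c} → (∀ i → r i ≡ s i) → ∀ U → sumRows r U ≡ sumRows s U
  sumRows-cong {zero}  h []      = refl
  sumRows-cong {suc m} h (b ∷ U) = cong₂ (λ v w → b • v ⊕ w) (h zero) (sumRows-cong (h ∘ suc) U)

  sumRows-∅ : (r : Fin m → Vec Bool c) → sumRows r ∅ ≡ zeroV
  sumRows-∅ {zero}  r = refl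
  sumRows-∅ {suc m} r = trans (⊕-identityˡ _) (sumRows-∅ (r ∘ suc))

  sumRows-⁅⁆ : (r : Fin m → Vec Bool c) (t : Fin m) → sumRows r ⁅ t ⁆ ≡ r t
  sumRows-⁅⁆ r zero    = trans (cong (r zero ⊕_) (sumRows-∅ (r ∘ suc))) (⊕-identityʳ (r zero))
  sumRows-⁅⁆ r (suc t) = trans (⊕-identityˡ _) (sumRows-⁅⁆ (r ∘ suc) t)

  sumRows-zeroRows : ∀ (U : Subset m) → sumRows (λ _ → zeroV {c}) U ≡ zeroV
  sumRows-zeroRows []          = refl
  sumRows-zeroRows (true ∷ U)  = trans (⊕-identityˡ _) (sumRows-zeroRows U)
  sumRows-zeroRows (false ∷ U) = trans (⊕-identityˡ _) (sumRows-zeroRows U)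

  sumRows-⊕ : (r : Fin m → Vec Bool c) (U W : Subset m) → sumRows r (U ⊕ W) ≡ sumRows r U ⊕ sumRows r W
  sumRows-⊕ {zero}  r []      []      = sym (⊕-identityˡ zeroV)
  sumRows-⊕ {suc m} r (a ∷ U) (b ∷ W) = begin
    (a xor b) • r zero ⊕ sumRows (r ∘ suc) (U ⊕ W)
      ≡⟨ cong₂ _⊕_ (•-distrib-xor a b (r zero)) (sumRows-⊕ (r ∘ suc) U W) ⟩
    (a • r zero ⊕ b • r zero) ⊕ (sumRows (r ∘ suc) U ⊕ sumRows (r ∘ suc) W)
      ≡⟨ ⊕-interchange _ _ _ _ ⟩
    (a • r zero ⊕ sumRows (r ∘ suc) U) ⊕ (b • r zero ⊕ sumRows (r ∘ suc) W) ∎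
    where open ≡-Reasoning

  sumRows-insertAt : (r : Fin (suc m) → Vec Bool c) (u : Fin (suc m)) (U : Subset m) (b : Bool) →
                     sumRows r (insertAt U u b) ≡ b • r u ⊕ sumRows (r ∘ punchIn u) U
  sumRows-insertAt r zero    U       b = refl
  sumRows-insertAt r (suc u) (a ∷ U) b = begin
    a • r zero ⊕ sumRows (r ∘ suc) (insertAt U u b)
      ≡⟨ cong (a • r zero ⊕_) (sumRows-insertAt (r ∘ suc) u U b) ⟩
    a • r zero ⊕ (b • r (suc u) ⊕ sumRows (r ∘ suc ∘ punchIn u) U)
      ≡⟨ ⊕-leftSwap _ _ _ ⟩
    b • r (suc u) ⊕ (a • r zero ⊕ sumRows (r ∘ suc ∘ punchIn u) U) ∎
    where open ≡-Reasoning

  lookup-sumRows-cong : ∀ (r : Fin m → Vec Bool c) {c′} (s : Fin m → Vec Bool c′) {U t t′} →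
                        (∀ {i} → i ∈ U → lookup (r i) t ≡ lookup (s i) t′) →
                        lookup (sumRows r U) t ≡ lookup (sumRows s U) t′
  lookup-sumRows-cong {zero} r s {[]} {t} {t′} h = trans (lookup-zeroV t) (sym (lookup-zeroV t′))
  lookup-sumRows-cong {suc m} r s {true ∷ U} {t} {t′} h = begin
    lookup (r zero ⊕ sumRows (r ∘ suc) U) t
      ≡⟨ lookup-zipWith _xor_ t (r zero) (sumRows (r ∘ suc) U) ⟩
    lookup (r zero) t xor lookup (sumRows (r ∘ suc) U) t
      ≡⟨ cong₂ _xor_ (h here) (lookup-sumRows-cong (r ∘ suc) (s ∘ suc) (h ∘ there)) ⟩
    lookup (s zero) t′ xor lookup (sumRows (s ∘ suc) U) t′
      ≡⟨ lookup-zipWith _xor_ t′ (s zero) (sumRows (s ∘ suc) U) ⟨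
    lookup (s zero ⊕ sumRows (s ∘ suc) U) t′ ∎
    where open ≡-Reasoning
  lookup-sumRows-cong {suc m} r s {false ∷ U} {t} {t′} h = begin
    lookup (zeroV ⊕ sumRows (r ∘ suc) U) t
      ≡⟨ cong (λ v → lookup v t) (⊕-identityˡ _) ⟩
    lookup (sumRows (r ∘ suc) U) t
      ≡⟨ lookup-sumRows-cong (r ∘ suc) (s ∘ suc) (h ∘ there) ⟩
    lookup (sumRows (s ∘ suc) U) t′
      ≡⟨ cong (λ v → lookup v t′) (⊕-identityˡ _) ⟨
    lookup (zeroV ⊕ sumRows (s ∘ suc) U) t′ ∎
    where open ≡-Reasoning

  lookup-sumRows-zeroColumn : ∀ (r : Fin m → Vec Bool c) {U t} → (∀ {i} → i ∈ U → lookup (r i) t ≡ false) →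
                              lookup (sumRows r U) t ≡ false
  lookup-sumRows-zeroColumn r {U} {t} zeroColumn = begin
    lookup (sumRows r U) t
      ≡⟨ lookup-sumRows-cong r (λ _ → zeroV) (λ i∈U → trans (zeroColumn i∈U) (sym (lookup-zeroV t))) ⟩
    lookup (sumRows (λ _ → zeroV) U) t
      ≡⟨ cong (λ w → lookup w t) (sumRows-zeroRows U) ⟩
    lookup zeroV t
      ≡⟨ lookup-zeroV t ⟩
    false ∎
    where open ≡-Reasoning

  Independent : (Fin m → Vec Bool c) → Subset m → Set
  Independent r T = ∀ {U} → U ⊆ T → Nonempty U → sumRows r U ≢ zeroV

  ⊆ᵇ-sound : ∀ (U T : Subset m) → U ⊆ᵇ T ≡ true → U ⊆ T
  ⊆ᵇ-sound (true ∷ U) (true ∷ T) h here       = here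
  ⊆ᵇ-sound (a    ∷ U) (b    ∷ T) h (there x∈) = there (⊆ᵇ-sound U T (proj₂ (∧-true⁻ {not a ∨ b} h)) x∈)

  ⊆ᵇ-complete : ∀ (U T : Subset m) → U ⊆ T → U ⊆ᵇ T ≡ true
  ⊆ᵇ-complete []          []      _   = refl
  ⊆ᵇ-complete (false ∷ U) (_ ∷ T) U⊆T = ⊆ᵇ-complete U T (drop-∷-⊆ U⊆T)
  ⊆ᵇ-complete (true ∷ U)  (_ ∷ T) U⊆T with U⊆T here
  ... | here = ⊆ᵇ-complete U T (drop-∷-⊆ U⊆T)

  nonEmpty-sound : ∀ (U : Subset m) → nonEmpty U ≡ true → Nonempty U
  nonEmpty-sound (true  ∷ U) _ = zero , here
  nonEmpty-sound (false ∷ U) h with nonEmpty-sound U h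
  ... | x , x∈U = suc x , there x∈U

  nonEmpty-complete : ∀ {U : Subset m} → Nonempty U → nonEmpty U ≡ true
  nonEmpty-complete (zero , here) = refl
  nonEmpty-complete {U = b ∷ U} (suc x , there x∈U) with b
  ... | true  = refl
  ... | false = nonEmpty-complete (x , x∈U)

  ∈-allSubsets : ∀ m (U : Subset m) → U ∈ₗ allSubsets m
  ∈-allSubsets zero    []          = Any.here refl
  ∈-allSubsets (suc m) (false ∷ U) = ∈-++⁺ˡ (∈-map⁺ (false ∷_) (∈-allSubsets m U))
  ∈-allSubsets (suc m) (true ∷ U)  = ∈-++⁺ʳ (List.map (false ∷_) (allSubsets m)) (∈-map⁺ (true ∷_) (∈-allSubsets m U))

  all-sound : ∀ {A : Set} (p : A → Bool) xs → BoolList.all p xs ≡ true → ∀ {x} → x ∈ₗ xs → p x ≡ true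
  all-sound p (y List.∷ xs) h (Any.here refl) = proj₁ (∧-true⁻ h)
  all-sound p (y List.∷ xs) h (Any.there x∈)  = all-sound p xs (proj₂ (∧-true⁻ {p y} h)) x∈

  all-complete : ∀ {A : Set} (p : A → Bool) xs → (∀ x → p x ≡ true) → BoolList.all p xs ≡ true
  all-complete p List.[]       h = refl
  all-complete p (x List.∷ xs) h rewrite h x = all-complete p xs h

  all-false : ∀ {A : Set} (p : A → Bool) xs → BoolList.all p xs ≡ false → ∃ λ x → p x ≡ false
  all-false p (x List.∷ xs) h with p x in eq
  ... | false = x , eq
  ... | true  = all-false p xs h

  independent-sound : ∀ (r : Fin m → Vec Bool c) T → independent r T ≡ true → Independent r T
  independent-sound {m} {c} r T h {U} U⊆T U≢∅ sum≡0
    with all-sound _ (allSubsets m) h (∈-allSubsets m U)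
  ... | holds rewrite ⊆ᵇ-complete U T U⊆T | nonEmpty-complete U≢∅ | sum≡0 | isZero-zeroV {c} with holds
  ... | ()

  independent-complete : ∀ (r : Fin m → Vec Bool c) T → Independent r T → independent r T ≡ true
  independent-complete {m} r T ind = all-complete _ (allSubsets m) holds
    where
    holds : ∀ U → (not ((U ⊆ᵇ T) ∧ nonEmpty U) ∨ not (isZero (sumRows r U))) ≡ true
    holds U with U ⊆ᵇ T in U⊆T | nonEmpty U in U≢∅ | isZero (sumRows r U) in sum≡0
    ... | false | _     | _     = refl
    ... | true  | false | _     = refl
    ... | true  | true  | false = refl
    ... | true  | true  | true  =
      contradiction (isZero-sound _ sum≡0) (ind (⊆ᵇ-sound U T U⊆T) (nonEmpty-sound U U≢∅))

  independent-false : ∀ (r : Fin m → Vec Bool c) T → independent r T ≡ false →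
                      ∃ λ U → U ⊆ T × Nonempty U × sumRows r U ≡ zeroV
  independent-false {m} r T h with all-false _ (allSubsets m) h
  ... | U , _ with U ⊆ᵇ T in U⊆T | nonEmpty U in U≢∅ | isZero (sumRows r U) in sum≡0
  ... | true | true | true = U , ⊆ᵇ-sound U T U⊆T , nonEmpty-sound U U≢∅ , isZero-sound _ sum≡0

  module _ (r : Fin m → Vec Bool c) (S : Subset m) where

    private
      candidate : Subset m → Bool
      candidate T = (T ⊆ᵇ S) ∧ independent r T

    rank-≥ : ∀ {T} → T ⊆ S → Independent r T → ∣ T ∣ ≤ rankGF2 r S
    rank-≥ {T} T⊆S ind =
      foldr-preservesᵒ (λ x y → [ (λ le → ≤-trans le (m≤m⊔n x y)) , (λ le → ≤-trans le (m≤n⊔m x y)) ]) 0 _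
        (inj₂ (Any.map ≤-reflexive (∈-map⁺ ∣_∣ (∈-filter⁺ (T? ∘ candidate) (∈-allSubsets m T)
          (Equivalence.from T-≡ (cong₂ _∧_ (⊆ᵇ-complete T S T⊆S) (independent-complete r T ind)))))))

    rank-witness : ∃ λ T → T ⊆ S × Independent r T × ∣ T ∣ ≡ rankGF2 r S
    rank-witness with foldr-selective ⊔-sel 0 (List.map ∣_∣ (List.filterᵇ candidate (allSubsets m)))
    ... | inj₁ rank≡0 =
      ∅ , (λ x∈∅ → contradiction x∈∅ ∉⊥) , (λ U⊆∅ (_ , x∈U) → contradiction (U⊆∅ x∈U) ∉⊥) ,
      trans (∣⊥∣≡0 m) (sym rank≡0)
    ... | inj₂ rank∈ with ∈-map⁻ ∣_∣ {xs = List.filterᵇ candidate (allSubsets m)} rank∈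
    ... | T , T∈ , rank≡∣T∣
      with ∧-true⁻ (Equivalence.to T-≡ (proj₂ (∈-filter⁻ (T? ∘ candidate) {xs = allSubsets m} T∈)))
    ... | T⊆S , indep = T , ⊆ᵇ-sound T S T⊆S , independent-sound r T indep , sym rank≡∣T∣

  rank-mono-dependencies : ∀ (r : Fin m → Vec Bool c) {c′} (s : Fin m → Vec Bool c′) S →
                           (∀ {U} → U ⊆ S → sumRows r U ≡ zeroV → sumRows s U ≡ zeroV) →
                           rankGF2 s S ≤ rankGF2 r S
  rank-mono-dependencies r s S dependent with rank-witness s S
  ... | T , T⊆S , ind , ∣T∣≡rank =
    subst (_≤ rankGF2 r S) ∣T∣≡rank
      (rank-≥ r S T⊆S λ U⊆T U≢∅ sum≡0 → ind U⊆T U≢∅ (dependent (T⊆S ∘ U⊆T) sum≡0))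

  module _ (r : Fin (suc m) → Vec Bool c) (u : Fin (suc m)) where

    Independent-deleteRow : ∀ {T a} → Independent r (insertAt T u a) → Independent (r ∘ punchIn u) T
    Independent-deleteRow ind {U} U⊆T U≢∅ sum≡0 =
      ind (insertAt-mono u U⊆T λ ()) (Nonempty-insertAt u false U≢∅)
        (trans (sumRows-insertAt r u U false) (trans (⊕-identityˡ _) sum≡0))

    dependent-inSpan : ∀ {T W} → W ⊆ T → r u ≡ sumRows (r ∘ punchIn u) W → ¬ Independent r (insertAt T u true)
    dependent-inSpan {W = W} W⊆T inSpan ind =
      ind (insertAt-mono u W⊆T λ _ → refl) (u , ∈-insertAt-self W u) (begin
        sumRows r (insertAt W u true)    ≡⟨ sumRows-insertAt r u W true ⟩
        r u ⊕ sumRows (r ∘ punchIn u) W  ≡⟨ cong (r u ⊕_) inSpan ⟨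
        r u ⊕ r u                        ≡⟨ ⊕-self (r u) ⟩
        zeroV                            ∎)
      where open ≡-Reasoning

    rank-insertAt-cases : ∀ S b → rankGF2 r (insertAt S u b) ≤ rankGF2 (r ∘ punchIn u) S ⊎
                          ∃ λ T → T ⊆ S × b ≡ true × Independent r (insertAt T u true) ×
                                  ∣ T ∣ ≤ rankGF2 (r ∘ punchIn u) S × suc ∣ T ∣ ≡ rankGF2 r (insertAt S u b)
    rank-insertAt-cases S b with rank-witness r (insertAt S u b)
    ... | T₀ , T₀⊆ , ind , ∣T₀∣≡rank with ⊆-insertAt-view u T₀⊆
    ... | T , false , refl , T⊆S , _ =
      inj₁ (subst (_≤ _) (trans (sym (∣insertAt-false∣ T u)) ∣T₀∣≡rank) (rank-≥ _ S T⊆S (Independent-deleteRow ind)))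
    ... | T , true  , refl , T⊆S , a⇒b =
      inj₂ (T , T⊆S , a⇒b refl , ind , rank-≥ _ S T⊆S (Independent-deleteRow ind) ,
            trans (sym (∣insertAt-true∣ T u)) ∣T₀∣≡rank)

    rank-insertAt-false : ∀ S → rankGF2 r (insertAt S u false) ≤ rankGF2 (r ∘ punchIn u) S
    rank-insertAt-false S with rank-insertAt-cases S false
    ... | inj₁ le = le
    ... | inj₂ (_ , _ , () , _)

    rank-insertAt-true : ∀ S → rankGF2 r (insertAt S u true) ≤ suc (rankGF2 (r ∘ punchIn u) S)
    rank-insertAt-true S with rank-insertAt-cases S true
    ... | inj₁ le                         = m≤n⇒m≤1+n le
    ... | inj₂ (_ , _ , _ , _ , le , eq) = subst (_≤ suc (rankGF2 (r ∘ punchIn u) S)) eq (s≤s le)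

    rank-insertAt-zeroRow : r u ≡ zeroV → ∀ S → rankGF2 r (insertAt S u true) ≤ rankGF2 (r ∘ punchIn u) S
    rank-insertAt-zeroRow zeroRow S with rank-insertAt-cases S true
    ... | inj₁ le                    = le
    ... | inj₂ (_ , _ , _ , ind , _) =
      ⊥-elim (dependent-inSpan (λ x∈∅ → contradiction x∈∅ ∉⊥) (trans zeroRow (sym (sumRows-∅ (r ∘ punchIn u)))) ind)

  -- Rows u and punchIn u t being equal, exchanging them turns a dependency of the new set into one of the old.
  Independent-exchange : ∀ {k} (r : Fin (suc (suc k)) → Vec Bool c) u t → r (punchIn u t) ≡ r u → ∀ {T} →
                         Independent r (insertAt (insertAt T t false) u true) →
                         Independent (r ∘ punchIn u) (insertAt T t true)
  Independent-exchange r u t duplicate ind U⊆ U≢∅ sum≡0 with ⊆-insertAt-view t U⊆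
  ... | U , false , refl , U⊆T , _ = Independent-deleteRow r u ind (insertAt-mono t U⊆T λ ()) U≢∅ sum≡0
  ... | U , true  , refl , U⊆T , _ =
    ind (insertAt-mono u (insertAt-mono t U⊆T λ ()) λ _ → refl) (u , ∈-insertAt-self _ u) (begin
      sumRows r (insertAt (insertAt U t false) u true)
        ≡⟨ sumRows-insertAt r u _ true ⟩
      r u ⊕ sumRows r′ (insertAt U t false)
        ≡⟨ cong (r u ⊕_) (trans (sumRows-insertAt r′ t U false) (⊕-identityˡ _)) ⟩
      r u ⊕ sumRows (r′ ∘ punchIn t) U
        ≡⟨ cong (_⊕ sumRows (r′ ∘ punchIn t) U) duplicate ⟨
      r′ t ⊕ sumRows (r′ ∘ punchIn t) U
        ≡⟨ sumRows-insertAt r′ t U true ⟨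
      sumRows r′ (insertAt U t true)
        ≡⟨ sum≡0 ⟩
      zeroV ∎)
    where
    open ≡-Reasoning
    r′ = r ∘ punchIn u

  rank-insertAt-duplicateRow : ∀ (r : Fin (suc m) → Vec Bool c) u {S t} → t ∈ S → r (punchIn u t) ≡ r u →
                               rankGF2 r (insertAt S u true) ≤ rankGF2 (r ∘ punchIn u) S
  rank-insertAt-duplicateRow {zero}  r u {t = ()}
  rank-insertAt-duplicateRow {suc m} r u {S} {t} t∈S duplicate with insertAt-view S t
  ... | S₀ , b , refl with ∈-insertAt-self⁻ t∈S
  ... | refl with rank-insertAt-cases r u (insertAt S₀ t true) true
  ... | inj₁ le = le
  ... | inj₂ (T , T⊆S , _ , ind , _ , eq) with insertAt-view T t
  ...   | T₀ , true  , refl =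
    ⊥-elim (dependent-inSpan r u ⁅t⁆⊆T (trans (sym duplicate) (sym (sumRows-⁅⁆ (r ∘ punchIn u) t))) ind)
    where
    ⁅t⁆⊆T : ⁅ t ⁆ ⊆ insertAt T₀ t true
    ⁅t⁆⊆T x∈⁅t⁆ = subst (_∈ insertAt T₀ t true) (sym (x∈⁅y⁆⇒x≡y t x∈⁅t⁆)) (∈-insertAt-self T₀ t)
  ...   | T₀ , false , refl =
    subst (_≤ rankGF2 (r ∘ punchIn u) (insertAt S₀ t true))
      (trans (∣insertAt-true∣ T₀ t) (trans (cong suc (sym (∣insertAt-false∣ T₀ t))) eq))
      (rank-≥ (r ∘ punchIn u) _ (insertAt-mono t (proj₁ (insertAt-⊆⁻ t T⊆S)) λ _ → refl)
        (Independent-exchange r u t duplicate ind))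

  insertColumn : (Fin m → Vec Bool c) → Fin (suc c) → (Fin m → Bool) → Fin m → Vec Bool (suc c)
  insertColumn r v col i = insertAt (r i) v (col i)

  module _ (r : Fin m → Vec Bool c) (v : Fin (suc c)) (col : Fin m → Bool) where

    private
      q = insertColumn r v col

    sumRows-insertColumn-zero : ∀ {U} → sumRows r U ≡ zeroV → lookup (sumRows q U) v ≡ false → sumRows q U ≡ zeroV
    sumRows-insertColumn-zero {U} sum≡0 newEntry≡0 =
      lookup-ext λ y → trans (entry y (punchIn-view v y)) (sym (lookup-zeroV y))
      where
      entry : ∀ y → y ≡ v ⊎ ∃ (λ j → punchIn v j ≡ y) → lookup (sumRows q U) y ≡ false
      entry .v (inj₁ refl) = newEntry≡0
      entry .(punchIn v j) (inj₂ (j , refl)) = begin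
        lookup (sumRows q U) (punchIn v j)  ≡⟨ lookup-sumRows-cong q r (λ {i} _ → insertAt-punchIn (r i) v (col i) j) ⟩
        lookup (sumRows r U) j              ≡⟨ cong (λ w → lookup w j) sum≡0 ⟩
        lookup zeroV j                      ≡⟨ lookup-zeroV j ⟩
        false                               ∎
        where open ≡-Reasoning

    dependent-⊕ : ∀ {U W} → sumRows r U ≡ zeroV → sumRows r W ≡ zeroV →
                  lookup (sumRows q U) v ≡ lookup (sumRows q W) v → sumRows q (U ⊕ W) ≡ zeroV
    dependent-⊕ {U} {W} U-dep W-dep sameEntry = sumRows-insertColumn-zero
      (begin
        sumRows r (U ⊕ W)            ≡⟨ sumRows-⊕ r U W ⟩
        sumRows r U ⊕ sumRows r W    ≡⟨ cong₂ _⊕_ U-dep W-dep ⟩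
        zeroV ⊕ zeroV                ≡⟨ ⊕-self zeroV ⟩
        zeroV                        ∎)
      (begin
        lookup (sumRows q (U ⊕ W)) v                       ≡⟨ cong (λ w → lookup w v) (sumRows-⊕ q U W) ⟩
        lookup (sumRows q U ⊕ sumRows q W) v               ≡⟨ lookup-zipWith _xor_ v (sumRows q U) (sumRows q W) ⟩
        lookup (sumRows q U) v xor lookup (sumRows q W) v  ≡⟨ cong (_xor lookup (sumRows q W) v) sameEntry ⟩
        lookup (sumRows q W) v xor lookup (sumRows q W) v  ≡⟨ xor-same (lookup (sumRows q W) v) ⟩
        false                                              ∎)
      where open ≡-Reasoning

    rank-insertColumn : ∀ S → (∀ {U} → U ⊆ S → sumRows r U ≡ zeroV → lookup (sumRows q U) v ≡ false) →
                        rankGF2 q S ≤ rankGF2 r S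
    rank-insertColumn S newEntry≡0 =
      rank-mono-dependencies r q S λ U⊆S sum≡0 → sumRows-insertColumn-zero sum≡0 (newEntry≡0 U⊆S sum≡0)

    rank-insertColumn-zeroColumn : ∀ S → (∀ {i} → i ∈ S → col i ≡ false) → rankGF2 q S ≤ rankGF2 r S
    rank-insertColumn-zeroColumn S zeroColumn = rank-insertColumn S λ U⊆S _ →
      lookup-sumRows-zeroColumn q λ {i} i∈U → trans (insertAt-lookup (r i) v (col i)) (zeroColumn (U⊆S i∈U))

    rank-insertColumn-duplicateColumn : ∀ S t → (∀ {i} → i ∈ S → col i ≡ lookup (r i) t) → rankGF2 q S ≤ rankGF2 r S
    rank-insertColumn-duplicateColumn S t duplicate = rank-insertColumn S λ {U} U⊆S sum≡0 → begin
      lookup (sumRows q U) v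
        ≡⟨ lookup-sumRows-cong q r (λ {i} i∈U → trans (insertAt-lookup (r i) v (col i)) (duplicate (U⊆S i∈U))) ⟩
      lookup (sumRows r U) t
        ≡⟨ cong (λ w → lookup w t) sum≡0 ⟩
      lookup zeroV t
        ≡⟨ lookup-zeroV t ⟩
      false ∎
      where open ≡-Reasoning

    -- Inside a q-independent T every dependency of r has new-column sum 1, so the sum of two distinct ones
    -- would be a dependency of q: removing from T one element of a dependency of r leaves an r-independent set.
    rank-insertColumn-suc : ∀ S → rankGF2 q S ≤ suc (rankGF2 r S)
    rank-insertColumn-suc S with rank-witness q S
    ... | T , T⊆S , indq , ∣T∣≡rank with independent r T in indep?
    ...   | true  = subst (_≤ suc (rankGF2 r S)) ∣T∣≡rank (m≤n⇒m≤1+n (rank-≥ r S T⊆S (independent-sound r T indep?)))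
    ...   | false with independent-false r T indep?
    ...     | U₀ , U₀⊆T , (x , x∈U₀) , U₀-dep =
      subst (_≤ suc (rankGF2 r S)) (trans (suc∣p∖x∣ T (U₀⊆T x∈U₀)) ∣T∣≡rank)
        (s≤s (rank-≥ r S (T⊆S ∘ p─q⊆p T ⁅ x ⁆) indT∖x))
      where
      newEntry≡1 : ∀ {U} → U ⊆ T → Nonempty U → sumRows r U ≡ zeroV → lookup (sumRows q U) v ≡ true
      newEntry≡1 {U} U⊆T U≢∅ sum≡0 with lookup (sumRows q U) v in entry
      ... | true  = refl
      ... | false = contradiction (sumRows-insertColumn-zero sum≡0 entry) (indq U⊆T U≢∅)

      indT∖x : Independent r (T ∖ x)
      indT∖x {U} U⊆T∖x U≢∅ sum≡0 =
        indq (λ y∈ → [ U₀⊆T , U⊆T ] (∈-⊕⁻ y∈)) (x , ∈-⊕⁺ x∈U₀ (x∉p∖x T x ∘ U⊆T∖x))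
          (dependent-⊕ U₀-dep sum≡0
            (trans (newEntry≡1 U₀⊆T (x , x∈U₀) U₀-dep) (sym (newEntry≡1 U⊆T U≢∅ sum≡0))))
        where
        U⊆T : U ⊆ T
        U⊆T = p─q⊆p T ⁅ x ⁆ ∘ U⊆T∖x

module CutRank where

  open import Data.Nat using (_≤_)
  open Subsets
  open Rank

  cutMatrix : ∀ {n} → Graph n → Subset n → Fin n → Vec Bool n
  cutMatrix G X x = tabulate (λ y → adj G x y ∧ not (lookup X y))

  module _ {n} (G : Graph (suc n)) (u : Fin (suc n)) where

    private
      G′ = deleteVertex G u

    column : Bool → Fin n → Bool
    column b i = adj G (punchIn u i) u ∧ not b

    cutMatrix-deleteVertex : ∀ S b i →
                             cutMatrix G (insertAt S u b) (punchIn u i) ≡ insertColumn (cutMatrix G′ S) u (column b) i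
    cutMatrix-deleteVertex S b i =
      trans (tabulate-insertAt (λ y → adj G (punchIn u i) y ∧ not (lookup (insertAt S u b) y)) u)
        (cong₂ (λ w a → insertAt w u a)
          (tabulate-cong λ j → cong (λ a → adj G (punchIn u i) (punchIn u j) ∧ not a) (insertAt-punchIn S u b j))
          (cong (λ a → adj G (punchIn u i) u ∧ not a) (insertAt-lookup S u b)))

    rank-cutMatrix-punchIn : ∀ S b → rankGF2 (cutMatrix G (insertAt S u b) ∘ punchIn u) S ≤
                                     rankGF2 (insertColumn (cutMatrix G′ S) u (column b)) S
    rank-cutMatrix-punchIn S b = rank-mono-dependencies (insertColumn (cutMatrix G′ S) u (column b)) _ S
      λ {U} _ sum≡0 → trans (sumRows-cong (cutMatrix-deleteVertex S b) U) sum≡0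

    rank-cutMatrix-inside : ∀ S → rankGF2 (cutMatrix G (insertAt S u true) ∘ punchIn u) S ≤ cutRank G′ S
    rank-cutMatrix-inside S =
      ≤-trans (rank-cutMatrix-punchIn S true) (rank-insertColumn-zeroColumn _ u _ S λ _ → ∧-zeroʳ _)

    cutRank-insertAt-≤suc : ∀ S b → cutRank G (insertAt S u b) ≤ suc (cutRank G′ S)
    cutRank-insertAt-≤suc S false =
      ≤-trans (rank-insertAt-false _ u S) (≤-trans (rank-cutMatrix-punchIn S false) (rank-insertColumn-suc _ u _ S))
    cutRank-insertAt-≤suc S true  = ≤-trans (rank-insertAt-true _ u S) (s≤s (rank-cutMatrix-inside S))

    cutRank-insertAt-twin : ∀ S b t → (∀ z → adj G u z ≡ adj G (punchIn u t) z) → lookup S t ≡ b →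
                            cutRank G (insertAt S u b) ≤ cutRank G′ S
    cutRank-insertAt-twin S true t twin t∈S = ≤-trans
      (rank-insertAt-duplicateRow _ u (lookup⇒∈ t∈S)
        (tabulate-cong λ y → cong (_∧ not (lookup (insertAt S u true) y)) (sym (twin y))))
      (rank-cutMatrix-inside S)
    cutRank-insertAt-twin S false t twin t∉S = ≤-trans (rank-insertAt-false _ u S)
      (≤-trans (rank-cutMatrix-punchIn S false) (rank-insertColumn-duplicateColumn _ u _ S t λ {i} _ → begin
        adj G (punchIn u i) u ∧ true
          ≡⟨ ∧-identityʳ _ ⟩
        adj G (punchIn u i) u
          ≡⟨ adj-sym G _ u ⟩
        adj G u (punchIn u i)
          ≡⟨ twin (punchIn u i) ⟩
        adj G (punchIn u t) (punchIn u i)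
          ≡⟨ adj-sym G _ _ ⟩
        adj G (punchIn u i) (punchIn u t)
          ≡⟨ ∧-identityʳ _ ⟨
        adj G (punchIn u i) (punchIn u t) ∧ true
          ≡⟨ cong (λ a → adj G (punchIn u i) (punchIn u t) ∧ not a) t∉S ⟨
        adj G (punchIn u i) (punchIn u t) ∧ not (lookup S t)
          ≡⟨ lookup∘tabulate (λ y → adj G (punchIn u i) (punchIn u y) ∧ not (lookup S y)) t ⟨
        lookup (cutMatrix G′ S i) t ∎))
      where open ≡-Reasoning

    cutRank-insertAt-neighbours : ∀ S b → (∀ j → adj G u (punchIn u j) ≡ true → lookup S j ≡ b) →
                                  cutRank G (insertAt S u b) ≤ cutRank G′ S
    cutRank-insertAt-neighbours S true neighbours = ≤-trans (rank-insertAt-zeroRow _ u rowZero S) (rank-cutMatrix-inside S)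
      where
      entry : ∀ y → y ≡ u ⊎ ∃ (λ j → punchIn u j ≡ y) → adj G u y ∧ not (lookup (insertAt S u true) y) ≡ false
      entry .u (inj₁ refl) = cong (_∧ _) (irrefl G u)
      entry .(punchIn u j) (inj₂ (j , refl)) rewrite insertAt-punchIn S u true j with adj G u (punchIn u j) in adjacent
      ... | false = refl
      ... | true  rewrite neighbours j adjacent = refl
      rowZero : cutMatrix G (insertAt S u true) u ≡ zeroV
      rowZero = lookup-ext λ y →
        trans (lookup∘tabulate (λ y → adj G u y ∧ not (lookup (insertAt S u true) y)) y)
              (trans (entry y (punchIn-view u y)) (sym (lookup-zeroV y)))
    cutRank-insertAt-neighbours S false neighbours = ≤-trans (rank-insertAt-false _ u S)
      (≤-trans (rank-cutMatrix-punchIn S false) (rank-insertColumn-zeroColumn _ u _ S columnZero))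
      where
      columnZero : ∀ {i} → i ∈ S → column false i ≡ false
      columnZero {i} i∈S with adj G (punchIn u i) u in adjacent
      ... | false = refl
      ... | true  = contradiction (trans (sym (∈⇒lookup i∈S)) (neighbours i (trans (adj-sym G u _) adjacent))) λ ()

module Counting where

  open import Data.Nat using (_≤_)
  open Subsets

  sumSubsets : (Subset m → ℕ) → ℕ
  sumSubsets {m} f = sum (List.map f (allSubsets m))

  sum-map-+ : ∀ {A : Set} (f g : A → ℕ) xs →
              sum (List.map (λ x → f x + g x) xs) ≡ sum (List.map f xs) + sum (List.map g xs)
  sum-map-+ f g List.[]       = refl
  sum-map-+ f g (x List.∷ xs) = trans (cong (_+_ (f x + g x)) (sum-map-+ f g xs)) (+-+-swap (f x) (g x) _ _)
    where
    +-+-swap : ∀ a b c d → (a + b) + (c + d) ≡ (a + c) + (b + d)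
    +-+-swap = solve-∀

  sum-map-mono : ∀ {A : Set} {f g : A → ℕ} → (∀ x → f x ≤ g x) → ∀ xs → sum (List.map f xs) ≤ sum (List.map g xs)
  sum-map-mono f≤g List.[]       = z≤n
  sum-map-mono f≤g (x List.∷ xs) = +-mono-≤ (f≤g x) (sum-map-mono f≤g xs)

  sum-map-zero : ∀ {A : Set} (xs : List A) → sum (List.map (λ _ → 0) xs) ≡ 0
  sum-map-zero List.[]       = refl
  sum-map-zero (x List.∷ xs) = sum-map-zero xs

  sumSubsets-cong : ∀ {f g : Subset m → ℕ} → (∀ S → f S ≡ g S) → sumSubsets f ≡ sumSubsets g
  sumSubsets-cong {m} f≗g = cong sum (map-cong f≗g (allSubsets m))

  sumSubsets-suc : (f : Subset (suc m) → ℕ) → sumSubsets f ≡ sumSubsets (f ∘ (false ∷_)) + sumSubsets (f ∘ (true ∷_))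
  sumSubsets-suc {m} f = begin
    sum (List.map f (List.map (false ∷_) L List.++ List.map (true ∷_) L))
      ≡⟨ cong sum (map-++ f (List.map (false ∷_) L) _) ⟩
    sum (List.map f (List.map (false ∷_) L) List.++ List.map f (List.map (true ∷_) L))
      ≡⟨ sum-++ (List.map f (List.map (false ∷_) L)) _ ⟩
    sum (List.map f (List.map (false ∷_) L)) + sum (List.map f (List.map (true ∷_) L))
      ≡⟨ cong₂ _+_ (cong sum (map-∘ L)) (cong sum (map-∘ L)) ⟨
    sumSubsets (f ∘ (false ∷_)) + sumSubsets (f ∘ (true ∷_)) ∎
    where
    open ≡-Reasoning
    L = allSubsets m

  sumSubsets-insertAt : ∀ (u : Fin (suc m)) f →
                        sumSubsets f ≡ sumSubsets (λ S → f (insertAt S u false) + f (insertAt S u true))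
  sumSubsets-insertAt {m} zero f =
    trans (sumSubsets-suc f) (sym (sum-map-+ (f ∘ (false ∷_)) (f ∘ (true ∷_)) (allSubsets m)))
  sumSubsets-insertAt {suc m} (suc u) f = begin
    sumSubsets f
      ≡⟨ sumSubsets-suc f ⟩
    sumSubsets (f ∘ (false ∷_)) + sumSubsets (f ∘ (true ∷_))
      ≡⟨ cong₂ _+_ (sumSubsets-insertAt u _) (sumSubsets-insertAt u _) ⟩
    sumSubsets (g ∘ (false ∷_)) + sumSubsets (g ∘ (true ∷_))
      ≡⟨ sumSubsets-suc g ⟨
    sumSubsets g ∎
    where
    open ≡-Reasoning
    g = λ S → f (insertAt S (suc u) false) + f (insertAt S (suc u) true)

  indicator : Bool → ℕ
  indicator true  = 1
  indicator false = 0

  count : (Subset m → Bool) → ℕ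
  count p = sumSubsets (indicator ∘ p)

  agree : Subset m → Subset m → Subset m → Bool
  agree []      []      []      = true
  agree (a ∷ M) (p ∷ P) (s ∷ S) = (not a ∨ not (s xor p)) ∧ agree M P S

  agree-sound : ∀ {M P S : Subset m} → agree M P S ≡ true → ∀ {i} → i ∈ M → lookup S i ≡ lookup P i
  agree-sound {M = true ∷ M} {p ∷ P} {s ∷ S} h here = same s p (proj₁ (∧-true⁻ h))
    where
    same : ∀ s p → not (s xor p) ≡ true → s ≡ p
    same true  true  _ = refl
    same false false _ = refl
  agree-sound {M = a ∷ M} {p ∷ P} {s ∷ S} h (there i∈M) = agree-sound (proj₂ (∧-true⁻ {not a ∨ not (s xor p)} h)) i∈M

  agree-false : ∀ {M P S : Subset m} → agree M P S ≡ false → ∃ λ i → i ∈ M × lookup S i ≢ lookup P i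
  agree-false {M = []} {[]} {[]} ()
  agree-false {M = a ∷ M} {p ∷ P} {s ∷ S} h with not a ∨ not (s xor p) in agreesHere
  ... | true with agree-false h
  ...   | i , i∈M , differ = suc i , there i∈M , differ
  agree-false {M = true ∷ M} {p ∷ P} {s ∷ S} h | false = zero , here , differ s p agreesHere
    where
    differ : ∀ s p → not (s xor p) ≡ false → s ≢ p
    differ true  true  () refl
    differ false false () refl

  agree-∪ : ∀ (M N P S : Subset m) → agree (M ∪ N) P S ≡ agree M P S ∧ agree N P S
  agree-∪ []      []      []      []      = refl
  agree-∪ (a ∷ M) (b ∷ N) (p ∷ P) (s ∷ S) rewrite agree-∪ M N P S =
    step a b (not (s xor p)) (agree M P S) (agree N P S)
    where
    step : ∀ a b e x y → (not (a ∨ b) ∨ e) ∧ (x ∧ y) ≡ ((not a ∨ e) ∧ x) ∧ ((not b ∨ e) ∧ y)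
    step true  true  true  x y = refl
    step true  false true  x y = refl
    step true  _     false x y = refl
    step false true  true  x y = refl
    step false true  false x y = sym (∧-zeroʳ x)
    step false false e     x y = refl

  count-agree : ∀ (M P : Subset m) → count (agree M P) * 2 ^ ∣ M ∣ ≡ 2 ^ m
  count-agree []          []      = refl
  count-agree {suc m} (false ∷ M) (p ∷ P) = begin
    count (agree (false ∷ M) (p ∷ P)) * 2 ^ ∣ M ∣
      ≡⟨ cong (_* 2 ^ ∣ M ∣) (sumSubsets-suc (indicator ∘ agree (false ∷ M) (p ∷ P))) ⟩
    (count (agree M P) + count (agree M P)) * 2 ^ ∣ M ∣
      ≡⟨ *-distribʳ-+ (2 ^ ∣ M ∣) (count (agree M P)) _ ⟩
    count (agree M P) * 2 ^ ∣ M ∣ + count (agree M P) * 2 ^ ∣ M ∣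
      ≡⟨ cong₂ _+_ (count-agree M P) (count-agree M P) ⟩
    2 ^ m + 2 ^ m
      ≡⟨ cong (_+_ (2 ^ m)) (+-identityʳ (2 ^ m)) ⟨
    2 ^ suc m ∎
    where open ≡-Reasoning
  count-agree {suc m} (true ∷ M) (p ∷ P) = begin
    count (agree (true ∷ M) (p ∷ P)) * 2 ^ suc ∣ M ∣
      ≡⟨ cong (_* 2 ^ suc ∣ M ∣) (trans (sumSubsets-suc (indicator ∘ agree (true ∷ M) (p ∷ P))) (oneSide p)) ⟩
    count (agree M P) * (2 * 2 ^ ∣ M ∣)
      ≡⟨ x*[2*y]≡2*[x*y] (count (agree M P)) (2 ^ ∣ M ∣) ⟩
    2 * (count (agree M P) * 2 ^ ∣ M ∣)
      ≡⟨ cong (2 *_) (count-agree M P) ⟩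
    2 * 2 ^ m ∎
    where
    open ≡-Reasoning
    x*[2*y]≡2*[x*y] : ∀ x y → x * (2 * y) ≡ 2 * (x * y)
    x*[2*y]≡2*[x*y] = solve-∀
    oneSide : ∀ p → count (agree (true ∷ M) (p ∷ P) ∘ (false ∷_)) + count (agree (true ∷ M) (p ∷ P) ∘ (true ∷_)) ≡
                    count (agree M P)
    oneSide true  = cong (_+ count (agree M P)) (sum-map-zero (allSubsets m))
    oneSide false = trans (cong (_+_ (count (agree M P))) (sum-map-zero (allSubsets m))) (+-identityʳ _)

  count-agree-∧-disagree-∪ : ∀ (A B P : Subset m) → (∀ {i} → i ∈ A → i ∉ B) →
                             count (λ S → agree A P S ∧ not (agree (A ∪ B) P S)) * 2 ^ (∣ A ∣ + ∣ B ∣) + 2 ^ m ≡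
                             2 ^ m * 2 ^ ∣ B ∣
  count-agree-∧-disagree-∪ {m} A B P disjoint = begin
    X * T + 2 ^ m                ≡⟨ cong (_+_ (X * T)) Y*T≡2^m ⟨
    X * T + Y * T                ≡⟨ *-distribʳ-+ T X Y ⟨
    (X + Y) * T                  ≡⟨ cong (_* T) X+Y≡Z ⟩
    Z * T                        ≡⟨ cong (Z *_) (^-distribˡ-+-* 2 ∣ A ∣ ∣ B ∣) ⟩
    Z * (2 ^ ∣ A ∣ * 2 ^ ∣ B ∣)  ≡⟨ *-assoc Z _ _ ⟨
    Z * 2 ^ ∣ A ∣ * 2 ^ ∣ B ∣    ≡⟨ cong (_* 2 ^ ∣ B ∣) (count-agree A P) ⟩
    2 ^ m * 2 ^ ∣ B ∣            ∎
    where
    open ≡-Reasoning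
    T = 2 ^ (∣ A ∣ + ∣ B ∣)
    X = count (λ S → agree A P S ∧ not (agree (A ∪ B) P S))
    Y = count (agree (A ∪ B) P)
    Z = count (agree A P)
    Y*T≡2^m : Y * T ≡ 2 ^ m
    Y*T≡2^m = subst (λ e → Y * 2 ^ e ≡ 2 ^ m) (∣∪∣-disjoint A B disjoint) (count-agree (A ∪ B) P)
    split : ∀ x y → indicator (x ∧ not (x ∧ y)) + indicator (x ∧ y) ≡ indicator x
    split true  true  = refl
    split true  false = refl
    split false y     = refl
    X+Y≡Z : X + Y ≡ Z
    X+Y≡Z = trans (sym (sum-map-+ _ _ (allSubsets m))) (sumSubsets-cong λ S →
      trans (cong (λ y → indicator (agree A P S ∧ not y) + indicator y) (agree-∪ A B P S))
            (split (agree A P S) (agree B P S)))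

module Dyadic where

  open import Data.Nat using (_≤_)
  open import Data.Integer as ℤ using (+≤+)
  open import Data.Integer.Properties using (pos-*; pos-+)
  open import Data.Rational as ℚ using (toℚᵘ) renaming (_≤_ to _≤ℚ_; _-_ to _-ℚ_)
  open import Data.Rational.Properties using (/-cong; toℚᵘ-fromℚᵘ; toℚᵘ-cancel-≤; toℚᵘ-homo-+; toℚᵘ-homo‿-)
  open import Data.Rational.Unnormalised as ℚᵘ using (ℚᵘ; mkℚᵘ; *≤*; _≃_) renaming (_≤_ to _≤ᵘ_)
  import Data.Rational.Unnormalised.Properties as ℚᵘₚ

  toℚᵘ-/2^ : ∀ z e → toℚᵘ (z /2^ e) ≃ mkℚᵘ z (pred (2 ^ e))
  toℚᵘ-/2^ z e = subst (λ w → toℚᵘ w ≃ mkℚᵘ z (pred (2 ^ e))) (sym z/2^e≡) (toℚᵘ-fromℚᵘ (mkℚᵘ z (pred (2 ^ e))))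
    where
    z/2^e≡ : z /2^ e ≡ z ℚ./ suc (pred (2 ^ e))
    z/2^e≡ = /-cong {p₁ = z} {{m^n≢0 2 e}} refl (sym (suc-pred (2 ^ e) {{m^n≢0 2 e}}))

  mkℚᵘ-sub-≤ : ∀ p q d a b c → p * (suc c * suc b) ≤ (q * suc b + d * suc c) * suc a →
               mkℚᵘ (+ p) a ℚᵘ.- mkℚᵘ (+ d) b ≤ᵘ mkℚᵘ (+ q) c
  mkℚᵘ-sub-≤ p q d a b c cross = ℚᵘₚ.≤-respʳ-≃ z+y-y≃z (ℚᵘₚ.+-monoˡ-≤ (ℚᵘ.- y) x≤z+y)
    where
    x y z : ℚᵘ
    x = mkℚᵘ (+ p) a
    y = mkℚᵘ (+ d) b
    z = mkℚᵘ (+ q) c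
    z+y-y≃z : (z ℚᵘ.+ y) ℚᵘ.- y ≃ z
    z+y-y≃z = ℚᵘₚ.≃-trans (ℚᵘₚ.+-assoc z y (ℚᵘ.- y))
                (ℚᵘₚ.≃-trans (ℚᵘₚ.+-congʳ z (ℚᵘₚ.+-inverseʳ y)) (ℚᵘₚ.+-identityʳ z))
    x≤z+y : x ≤ᵘ z ℚᵘ.+ y
    x≤z+y = *≤* (subst₂ ℤ._≤_ (pos-* p _) cross≡ (+≤+ cross))
      where
      cross≡ : + ((q * suc b + d * suc c) * suc a) ≡ (+ q ℤ.* + suc b ℤ.+ + d ℤ.* + suc c) ℤ.* + suc a
      cross≡ = trans (pos-* (q * suc b + d * suc c) (suc a))
                 (cong (ℤ._* + suc a) (trans (pos-+ (q * suc b) _) (cong₂ ℤ._+_ (pos-* q _) (pos-* d _))))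

  /2^-sub-≤ : ∀ p q d a b c → p * (2 ^ c * 2 ^ b) ≤ (q * 2 ^ b + d * 2 ^ c) * 2 ^ a →
              (+ p) /2^ a -ℚ (+ d) /2^ b ≤ℚ (+ q) /2^ c
  /2^-sub-≤ p q d a b c cross =
    toℚᵘ-cancel-≤ (ℚᵘₚ.≤-respˡ-≃ (ℚᵘₚ.≃-sym toℚᵘ-lhs) (ℚᵘₚ.≤-respʳ-≃ (ℚᵘₚ.≃-sym (toℚᵘ-/2^ (+ q) c))
      (mkℚᵘ-sub-≤ p q d _ _ _ (subst₂ _≤_ (cong (p *_) (cong₂ _*_ (sucPred c) (sucPred b)))
        (cong₂ _*_ (cong₂ _+_ (cong (q *_) (sucPred b)) (cong (d *_) (sucPred c))) (sucPred a)) cross))))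
    where
    sucPred : ∀ e → 2 ^ e ≡ suc (pred (2 ^ e))
    sucPred e = sym (suc-pred (2 ^ e) {{m^n≢0 2 e}})
    toℚᵘ-lhs : toℚᵘ ((+ p) /2^ a -ℚ (+ d) /2^ b) ≃ mkℚᵘ (+ p) (pred (2 ^ a)) ℚᵘ.- mkℚᵘ (+ d) (pred (2 ^ b))
    toℚᵘ-lhs = ℚᵘₚ.≃-trans (toℚᵘ-homo-+ ((+ p) /2^ a) (ℚ.- ((+ d) /2^ b)))
                 (ℚᵘₚ.+-cong (toℚᵘ-/2^ (+ p) a) (ℚᵘₚ.≃-trans (toℚᵘ-homo‿- ((+ d) /2^ b)) (ℚᵘₚ.-‿cong (toℚᵘ-/2^ (+ d) b))))

module TwinDeletion {n k} (G : Graph (suc n)) (u : Fin (suc k) → Fin (suc n))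
                    (twins : ∀ i j → i ≢ j → FalseTwins G (u i) (u j)) where

  open import Data.Nat using (_≤_)
  open Subsets
  open CutRank
  open Counting

  private
    u₀ = u zero
    G′ = deleteVertex G u₀
    d = degree G u₀

  u₀≢ : ∀ j → u₀ ≢ u (suc j)
  u₀≢ j = proj₁ (twins zero (suc j) λ ())

  otherTwin : Fin k → Fin n
  otherTwin j = punchOut (u₀≢ j)

  punchIn-otherTwin : ∀ j → punchIn u₀ (otherTwin j) ≡ u (suc j)
  punchIn-otherTwin j = punchIn-punchOut (u₀≢ j)

  otherTwin-injective : Injective _≡_ _≡_ otherTwin
  otherTwin-injective {i} {j} eq with i ≟ j
  ... | yes i≡j = i≡j
  ... | no  i≢j = contradiction (trans (sym (punchIn-otherTwin i)) (trans (cong (punchIn u₀) eq) (punchIn-otherTwin j)))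
                                (proj₁ (twins (suc i) (suc j) (i≢j ∘ suc-injective)))

  A B : Subset n
  A = image otherTwin
  B = tabulate (adj G u₀ ∘ punchIn u₀)

  ∣A∣≡k : ∣ A ∣ ≡ k
  ∣A∣≡k = ∣image∣ otherTwin otherTwin-injective

  ∣B∣≡d : ∣ B ∣ ≡ d
  ∣B∣≡d = begin
    ∣ B ∣                            ≡⟨ ∣insertAt-false∣ B u₀ ⟨
    ∣ insertAt B u₀ false ∣          ≡⟨ cong (∣_∣ ∘ insertAt B u₀) (irrefl G u₀) ⟨
    ∣ insertAt B u₀ (adj G u₀ u₀) ∣  ≡⟨ cong ∣_∣ (tabulate-insertAt (adj G u₀) u₀) ⟨
    ∣ tabulate (adj G u₀) ∣          ∎
    where open ≡-Reasoning

  A-twin : ∀ {t} → t ∈ A → ∀ z → adj G u₀ z ≡ adj G (punchIn u₀ t) z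
  A-twin t∈A z with ∈-image⁻ otherTwin t∈A
  ... | j , refl = trans (proj₂ (proj₂ (twins zero (suc j) λ ())) z) (cong (λ v → adj G v z) (sym (punchIn-otherTwin j)))

  A∩B≡∅ : ∀ {t} → t ∈ A → t ∉ B
  A∩B≡∅ t∈A t∈B with ∈-image⁻ otherTwin t∈A
  ... | j , refl = contradiction (trans (sym (∈⇒lookup t∈B)) (begin
    lookup B (otherTwin j)               ≡⟨ lookup∘tabulate (adj G u₀ ∘ punchIn u₀) (otherTwin j) ⟩
    adj G u₀ (punchIn u₀ (otherTwin j))  ≡⟨ cong (adj G u₀) (punchIn-otherTwin j) ⟩
    adj G u₀ (u (suc j))                 ≡⟨ proj₁ (proj₂ (twins zero (suc j) λ ())) ⟩
    false                                ∎)) λ ()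
    where open ≡-Reasoning

  -- With u₀ on side b, the pattern map (b xor_) A puts the other twins on side not b and everything else on
  -- side b; S is bad when it agrees with it on A but not on A ∪ B, i.e. some neighbour of u₀ is on side not b.
  bad : Bool → Subset n → Bool
  bad b S = agree A (map (b xor_) A) S ∧ not (agree (A ∪ B) (map (b xor_) A) S)

  cutRank-insertAt-≤-bad : ∀ S b → cutRank G (insertAt S u₀ b) ≤ cutRank G′ S + indicator (bad b S)
  cutRank-insertAt-≤-bad S b with agree A (map (b xor_) A) S in agreeA
  ... | false with agree-false agreeA
  ...   | t , t∈A , differ = ≤-trans (cutRank-insertAt-twin G u₀ S b t (A-twin t∈A) sameSide) (m≤m+n _ _)
    where
    opposite : ∀ x b → x ≢ b xor true → x ≡ b
    opposite true  true  _  = refl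
    opposite false false _  = refl
    opposite true  false ne = contradiction refl ne
    opposite false true  ne = contradiction refl ne
    sameSide : lookup S t ≡ b
    sameSide = opposite (lookup S t) b λ S[t]≡ →
      differ (trans S[t]≡ (sym (trans (lookup-map t (b xor_) A) (cong (b xor_) (∈⇒lookup t∈A)))))
  cutRank-insertAt-≤-bad S b | true with agree (A ∪ B) (map (b xor_) A) S in agreeA∪B
  ...   | true  = ≤-trans (cutRank-insertAt-neighbours G u₀ S b neighbours) (m≤m+n _ _)
    where
    neighbours : ∀ j → adj G u₀ (punchIn u₀ j) ≡ true → lookup S j ≡ b
    neighbours j adjacent = begin
      lookup S j                 ≡⟨ agree-sound {M = A ∪ B} {map (b xor_) A} {S} agreeA∪B (x∈p∪q⁺ (inj₂ j∈B)) ⟩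
      lookup (map (b xor_) A) j  ≡⟨ lookup-map j (b xor_) A ⟩
      b xor lookup A j           ≡⟨ cong (b xor_) (∉⇒lookup λ j∈A → A∩B≡∅ j∈A j∈B) ⟩
      b xor false                ≡⟨ xor-identityʳ b ⟩
      b                          ∎
      where
      open ≡-Reasoning
      j∈B : j ∈ B
      j∈B = lookup⇒∈ (trans (lookup∘tabulate (adj G u₀ ∘ punchIn u₀) j) adjacent)
  ...   | false = subst (cutRank G (insertAt S u₀ b) ≤_) (+-comm 1 _) (cutRank-insertAt-≤suc G u₀ S b)

  count-bad : ∀ b → count (bad b) * 2 ^ (k + d) ≡ 2 ^ n * (2 ^ d ∸ 1)
  count-bad b = begin
    count (bad b) * 2 ^ (k + d)                  ≡⟨ m+n∸n≡m _ (2 ^ n) ⟨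
    count (bad b) * 2 ^ (k + d) + 2 ^ n ∸ 2 ^ n  ≡⟨ cong (_∸ 2 ^ n) counted ⟩
    2 ^ n * 2 ^ d ∸ 2 ^ n                        ≡⟨ cong (2 ^ n * 2 ^ d ∸_) (*-identityʳ (2 ^ n)) ⟨
    2 ^ n * 2 ^ d ∸ 2 ^ n * 1                    ≡⟨ *-distribˡ-∸ (2 ^ n) (2 ^ d) 1 ⟨
    2 ^ n * (2 ^ d ∸ 1)                          ∎
    where
    open ≡-Reasoning
    counted : count (bad b) * 2 ^ (k + d) + 2 ^ n ≡ 2 ^ n * 2 ^ d
    counted = subst₂ (λ x y → count (bad b) * 2 ^ (x + y) + 2 ^ n ≡ 2 ^ n * 2 ^ y) ∣A∣≡k ∣B∣≡d
                (count-agree-∧-disagree-∪ A B (map (b xor_) A) A∩B≡∅)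

  sumSubsets-cutRank-≤ : sumSubsets (cutRank G) ≤
                         (sumSubsets (cutRank G′) + count (bad false)) + (sumSubsets (cutRank G′) + count (bad true))
  sumSubsets-cutRank-≤ = begin
    sumSubsets (cutRank G)
      ≡⟨ sumSubsets-insertAt u₀ (cutRank G) ⟩
    sumSubsets (λ S → cutRank G (insertAt S u₀ false) + cutRank G (insertAt S u₀ true))
      ≤⟨ sum-map-mono (λ S → +-mono-≤ (cutRank-insertAt-≤-bad S false) (cutRank-insertAt-≤-bad S true)) (allSubsets n) ⟩
    sumSubsets (λ S → (cutRank G′ S + indicator (bad false S)) + (cutRank G′ S + indicator (bad true S)))
      ≡⟨ trans (sum-map-+ _ _ (allSubsets n)) (cong₂ _+_ (sum-map-+ _ _ (allSubsets n)) (sum-map-+ _ _ (allSubsets n))) ⟩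
    (sumSubsets (cutRank G′) + count (bad false)) + (sumSubsets (cutRank G′) + count (bad true)) ∎
    where open ≤-Reasoning

  sumSubsets-cutRank-cross : sumSubsets (cutRank G) * (2 ^ n * 2 ^ (k + d)) ≤
                             (sumSubsets (cutRank G′) * 2 ^ (k + d) + (2 ^ d ∸ 1) * 2 ^ n) * 2 ^ suc n
  sumSubsets-cutRank-cross = begin
    P * (N * T)                                    ≤⟨ *-monoˡ-≤ (N * T) sumSubsets-cutRank-≤ ⟩
    ((Q + X₀) + (Q + X₁)) * (N * T)                ≡⟨ expand N Q X₀ X₁ T ⟩
    N * (X₀ * T) + N * (X₁ * T) + Q * T * (2 * N)  ≡⟨ cong₂ (λ x y → N * x + N * y + Q * T * (2 * N)) (count-bad false) (count-bad true) ⟩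
    N * (N * D) + N * (N * D) + Q * T * (2 * N)    ≡⟨ collect N Q T D ⟩
    (Q * T + D * N) * (2 * N)                      ∎
    where
    open ≤-Reasoning
    P = sumSubsets (cutRank G)
    Q = sumSubsets (cutRank G′)
    X₀ = count (bad false)
    X₁ = count (bad true)
    N = 2 ^ n
    T = 2 ^ (k + d)
    D = 2 ^ d ∸ 1
    expand : ∀ N Q x y T → ((Q + x) + (Q + y)) * (N * T) ≡ N * (x * T) + N * (y * T) + Q * T * (2 * N)
    expand = solve-∀
    collect : ∀ N Q T D → N * (N * D) + N * (N * D) + Q * T * (2 * N) ≡ (Q * T + D * N) * (2 * N)
    collect = solve-∀

open import Data.Rational using (_≤_; _-_)
open Dyadic using (/2^-sub-≤)
open Counting using (sumSubsets)

proposition4p5 : ∀ {n k : ℕ} (G : Graph (suc n)) (u : Fin (suc k) → Fin (suc n))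
    → (∀ i j → i ≢ j → FalseTwins G (u i) (u j))
    → (Eρ G - ((+ (2 ^ degree G (u zero) ∸ 1)) /2^ (suc k + degree G (u zero) ∸ 1))
         ≤ Eρ (deleteVertex G (u zero)))
      × (degree G (u zero) ≡ 1 → Eρ G - ((+ 1) /2^ (suc k)) ≤ Eρ (deleteVertex G (u zero)))
proposition4p5 {n} {k} G u twins = bound , bound-degree-one
  where
  open TwinDeletion G u twins using (sumSubsets-cutRank-cross)
  bound : Eρ G - ((+ (2 ^ degree G (u zero) ∸ 1)) /2^ (k + degree G (u zero))) ≤ Eρ (deleteVertex G (u zero))
  bound = /2^-sub-≤ (sumSubsets (cutRank G)) (sumSubsets (cutRank (deleteVertex G (u zero))))
                    (2 ^ degree G (u zero) ∸ 1) (suc n) (k + degree G (u zero)) n sumSubsets-cutRank-cross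
  bound-degree-one : degree G (u zero) ≡ 1 → Eρ G - ((+ 1) /2^ (suc k)) ≤ Eρ (deleteVertex G (u zero))
  bound-degree-one d≡1 =
    subst (λ e → Eρ G - ((+ 1) /2^ e) ≤ Eρ (deleteVertex G (u zero))) (+-comm k 1)
      (subst (λ d → Eρ G - ((+ (2 ^ d ∸ 1)) /2^ (k + d)) ≤ Eρ (deleteVertex G (u zero))) d≡1 bound)
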